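{- Let $k\ge 1$ and let the vertices of the path $P_{3k+1}$ be labeled $1,2,\ldots,3k+1$ consecutively along the path. Then $\tau(P_{3k+1})=\frac12(k^2+5k+2)$, and for each vertex $v$, writing $v=3q+r$ with integers $q\ge0$ and $0\le r<3$, $$DV_{P_{3k+1}}(v)=\begin{cases}\frac12 q(q+3) & \text{if } v\equiv 0\pmod 3,\\ (q+1)(k-q+1) & \text{if } v\equiv 1\pmod 3,\\ \frac12(k-q)(k-q+3) & \text{if } v\equiv 2\pmod 3.\end{cases}$$
   Context: All graphs are finite, simple and undirected. A set $D\subseteq V(G)$ is a dominating set of $G$ if every vertex not in $D$ is adjacent to at least one vertex of $D$. The domination number $\gamma(G)$ is the minimum cardinality of a dominating set; a dominating set of cardinality $\gamma(G)$ is a $\gamma(G)$-set. $\tau(G)$ denotes the total number of $\gamma(G)$-sets, and for $v\in V(G)$, $DV_G(v)$ is the number of $\gamma(G)$-sets containing $v$. -}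

module Defs where

open import Data.Bool using (Bool; true; false; _∧_; _∨_; if_then_else_)
open import Data.Nat using (ℕ; zero; suc; _⊓_; _≡ᵇ_; _∸_; _+_)
open import Data.Fin using (Fin; toℕ)
open import Data.Fin.Subset using (Subset; ∣_∣)
open import Data.Vec using (Vec; []; _∷_; lookup)
open import Data.List using (List; []; _∷_; map; length; foldr; allFin; _++_)

bfilter : ∀ {A : Set} → (A → Bool) → List A → List A
bfilter p [] = []
bfilter p (x ∷ xs) = if p x then x ∷ bfilter p xs else bfilter p xs

ball : ∀ {A : Set} → (A → Bool) → List A → Bool
ball p [] = true
ball p (x ∷ xs) = p x ∧ ball p xs

bany : ∀ {A : Set} → (A → Bool) → List A → Bool
bany p [] = false
bany p (x ∷ xs) = p x ∨ bany p xs

-- A finite simple graph on vertex set Fin n, given by a Boolean adjacency test.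
-- (Symmetry / irreflexivity are not needed for the definitions below; the only
-- graph used in the statement, the path, is simple.)
Graph : ℕ → Set
Graph n = Fin n → Fin n → Bool

-- The path P_n : vertices 0,…,n-1 (i.e. labels 1,…,n), i ~ j iff |i - j| = 1.
path : (n : ℕ) → Graph n
path n i j = ((toℕ i ∸ toℕ j) + (toℕ j ∸ toℕ i)) ≡ᵇ 1

isDominating : ∀ {n} → Graph n → Subset n → Bool
isDominating {n} G D =
  ball (λ v → lookup D v ∨ bany (λ u → lookup D u ∧ G u v) (allFin n)) (allFin n)

allSubsets : (n : ℕ) → List (Subset n)
allSubsets zero = [] ∷ []
allSubsets (suc n) = map (true ∷_) (allSubsets n) ++ map (false ∷_) (allSubsets n)

dominatingSets : ∀ {n} → Graph n → List (Subset n)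
dominatingSets {n} G = bfilter (isDominating G) (allSubsets n)

-- γ(G): minimum cardinality of a dominating set (V(G) itself, of size n,
-- is dominating, so n is a valid starting bound).
γ : ∀ {n} → Graph n → ℕ
γ {n} G = foldr _⊓_ n (map ∣_∣ (dominatingSets G))

γSets : ∀ {n} → Graph n → List (Subset n)
γSets G = bfilter (λ D → ∣ D ∣ ≡ᵇ γ G) (dominatingSets G)

τ : ∀ {n} → Graph n → ℕ
τ G = length (γSets G)

DV : ∀ {n} → Graph n → Fin n → ℕ
DV G v = length (bfilter (λ D → lookup D v) (γSets G))

module Submission where

open import Defs
open import Data.Bool using (Bool; true; false; _∧_; _∨_; T)
open import Data.Bool.Properties using (∧-zeroʳ; ∧-identityʳ)
open import Data.Fin using (Fin; toℕ; zero; suc)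
open import Data.Fin.Properties using (toℕ<n)
open import Data.Fin.Subset using (Subset; ∣_∣)
open import Data.List using (List; []; _∷_; length; map; foldr; _++_; take; drop; tabulate; allFin)
open import Data.List.Properties using (length-++; length-map; length-take; length-drop)
open import Data.Nat using (ℕ; zero; suc; _+_; _*_; _∸_; _≤_; _<_; _⊓_; _≡ᵇ_; _/_; _%_; z≤n; s≤s; z<s)
open import Data.Nat.DivMod using (m≡m%n+[m/n]*n)
open import Data.Nat.Properties
  using (+-identityʳ; +-suc; +-comm; *-identityˡ; *-identityʳ; *-distribˡ-+; *-distribʳ-+;
         ≤-trans; ≤-antisym; ≤-reflexive; ≤-pred; <⇒≤; <⇒≱; n<1+n; n≤1+n; m<n+m; m≤n+m; m+n≮n; m≤m*n;
         ⊓-glb; m⊓n≤m; m⊓n≤n; m≤n⇒m⊓n≡m; m+n∸m≡n; m≤n⇒∃[o]m+o≡n; *-cancelʳ-≤; *-cancelʳ-<;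
         ≡ᵇ⇒≡; suc-injective; 0≢1+n)
open import Data.Nat.Tactic.RingSolver using (solve-∀)
open import Data.Product using (_×_; ∃; _,_)
open import Data.Unit using (tt)
open import Data.Vec using ([]; _∷_; lookup; toList)
open import Data.Vec.Properties using (length-toList)
open import Function using (_∘_; id)
open import Relation.Binary.PropositionalEquality
  using (_≡_; _≢_; refl; sym; trans; cong; cong₂; subst; subst₂; module ≡-Reasoning)
open import Relation.Nullary using (contradiction)
open ≡-Reasoning

-- A dominating set of a path is a word over {in D, not in D} that a three-state automaton
-- accepts, so dominating sets of P_n of a given size are counted by a linear recurrence
-- in the length and the size. A vertex of D dominates at most three vertices, which gives
-- γ(P_{3k+1}) = k+1, and for this size the recurrence is solved along the lines
-- "length = 3·size + constant", where it yields constants, linear and quadratic terms.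
-- A γ-set containing v splits at v into an admissible prefix and an admissible suffix,
-- each of the least possible size, so DV(v) is a product of two such counts.

o+m*3≤n*3+2⇒m≤n : ∀ o {m n} → o + m * 3 ≤ n * 3 + 2 → m ≤ n
o+m*3≤n*3+2⇒m≤n o h = cancel (≤-trans (m≤n+m _ o) h)
  where
  cancel : ∀ {m n} → m * 3 ≤ n * 3 + 2 → m ≤ n
  cancel {zero} _ = z≤n
  cancel {suc m} {zero} (s≤s (s≤s ()))
  cancel {suc m} {suc n} (s≤s (s≤s (s≤s h))) = s≤s (cancel h)

n≡m+r⇒n∸m≡r : ∀ {m n r} → n ≡ m + r → n ∸ m ≡ r
n≡m+r⇒n∸m≡r {m} {r = r} refl = m+n∸m≡n m r

m<n⇒∃[o]m+1+o≡n : ∀ {m n} → m < n → ∃ λ o → m + suc o ≡ n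
m<n⇒∃[o]m+1+o≡n {m} m<n with m≤n⇒∃[o]m+o≡n m<n
... | o , eq = o , trans (+-suc m o) eq

≡ᵇ≡true⇒≡ : ∀ {m n} → (m ≡ᵇ n) ≡ true → m ≡ n
≡ᵇ≡true⇒≡ {m} {n} eq = ≡ᵇ⇒≡ m n (subst T (sym eq) tt)

≢⇒≡ᵇ≡false : ∀ {m n} → m ≢ n → (m ≡ᵇ n) ≡ false
≢⇒≡ᵇ≡false {m} {n} m≢n with m ≡ᵇ n in eq
... | false = refl
... | true = contradiction (≡ᵇ≡true⇒≡ eq) m≢n

+-suc-≡ᵇ-at-minimum : ∀ {a b j w} → j ≤ a → w ≤ b → (a + suc b ≡ᵇ j + suc w) ≡ (a ≡ᵇ j) ∧ (b ≡ᵇ w)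
+-suc-≡ᵇ-at-minimum {zero} z≤n _ = refl
+-suc-≡ᵇ-at-minimum {suc a} {b} z≤n w≤b =
  ≢⇒≡ᵇ≡false (λ eq → m+n≮n a b (subst (_≤ b) (trans (sym eq) (+-suc a b)) w≤b))
+-suc-≡ᵇ-at-minimum {suc a} (s≤s j≤a) w≤b = +-suc-≡ᵇ-at-minimum j≤a w≤b

∧-regroup : ∀ p q {e a b} → (p ≡ true → q ≡ true → e ≡ a ∧ b) → (p ∧ q) ∧ e ≡ (p ∧ a) ∧ (q ∧ b)
∧-regroup true true h = h refl refl
∧-regroup true false h = sym (∧-zeroʳ _)
∧-regroup false q h = refl

module _ {A : Set} where

  bfilter-++ : ∀ (p : A → Bool) xs ys → bfilter p (xs ++ ys) ≡ bfilter p xs ++ bfilter p ys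
  bfilter-++ p [] ys = refl
  bfilter-++ p (x ∷ xs) ys with p x
  ... | true = cong (x ∷_) (bfilter-++ p xs ys)
  ... | false = bfilter-++ p xs ys

  bfilter-map : ∀ {B : Set} (p : B → Bool) (f : A → B) xs → bfilter p (map f xs) ≡ map f (bfilter (p ∘ f) xs)
  bfilter-map p f [] = refl
  bfilter-map p f (x ∷ xs) with p (f x)
  ... | true = cong (f x ∷_) (bfilter-map p f xs)
  ... | false = bfilter-map p f xs

  bfilter-cong : ∀ {p q : A → Bool} → (∀ x → p x ≡ q x) → ∀ xs → bfilter p xs ≡ bfilter q xs
  bfilter-cong h [] = refl
  bfilter-cong {p} {q} h (x ∷ xs) with p x | q x | h x
  ... | true | true | refl = cong (x ∷_) (bfilter-cong h xs)
  ... | false | false | refl = bfilter-cong h xs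

  bfilter-bfilter : ∀ (p q : A → Bool) xs → bfilter q (bfilter p xs) ≡ bfilter (λ x → p x ∧ q x) xs
  bfilter-bfilter p q [] = refl
  bfilter-bfilter p q (x ∷ xs) with p x
  ... | false = bfilter-bfilter p q xs
  ... | true with q x
  ...   | true = cong (x ∷_) (bfilter-bfilter p q xs)
  ...   | false = bfilter-bfilter p q xs

  bfilter-none : ∀ (xs : List A) → bfilter (λ _ → false) xs ≡ []
  bfilter-none [] = refl
  bfilter-none (x ∷ xs) = bfilter-none xs

count : ℕ → (List Bool → Bool) → ℕ
count n P = length (bfilter (P ∘ toList) (allSubsets n))

count-suc : ∀ n P → count (suc n) P ≡ count n (λ L → P (true ∷ L)) + count n (λ L → P (false ∷ L))
count-suc n P = begin
  length (bfilter P′ (map (true ∷_) S ++ map (false ∷_) S))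
    ≡⟨ cong length (bfilter-++ P′ (map (true ∷_) S) _) ⟩
  length (bfilter P′ (map (true ∷_) S) ++ bfilter P′ (map (false ∷_) S))
    ≡⟨ length-++ (bfilter P′ (map (true ∷_) S)) ⟩
  length (bfilter P′ (map (true ∷_) S)) + length (bfilter P′ (map (false ∷_) S))
    ≡⟨ cong₂ _+_ (length-bfilter-map (true ∷_)) (length-bfilter-map (false ∷_)) ⟩
  count n (λ L → P (true ∷ L)) + count n (λ L → P (false ∷ L)) ∎
  where
  S = allSubsets n
  P′ : Subset (suc n) → Bool
  P′ = P ∘ toList
  length-bfilter-map : (f : Subset n → Subset (suc n)) → length (bfilter P′ (map f S)) ≡ length (bfilter (P′ ∘ f) S)
  length-bfilter-map f = trans (cong length (bfilter-map P′ f S)) (length-map f (bfilter (P′ ∘ f) S))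

count-cong : ∀ n {P Q : List Bool → Bool} → (∀ L → length L ≡ n → P L ≡ Q L) → count n P ≡ count n Q
count-cong n h = cong length (bfilter-cong (λ D → h (toList D) (length-toList D)) (allSubsets n))

count-false : ∀ n {P : List Bool → Bool} → (∀ L → length L ≡ n → P L ≡ false) → count n P ≡ 0
count-false n h = trans (count-cong n h) (cong length (bfilter-none (allSubsets n)))

-- Out-of-range positions read as false.
get : List Bool → ℕ → Bool
get [] _ = false
get (x ∷ L) zero = x
get (x ∷ L) (suc i) = get L i

count-split : ∀ {n i} → i < n → (Φ Ψ : List Bool → Bool) →
  count n (λ L → get L i ∧ (Φ (take i L) ∧ Ψ (drop (suc i) L))) ≡ count i Φ * count (n ∸ suc i) Ψ
count-split {suc n} {zero} _ Φ Ψ = begin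
  count (suc n) (λ L → get L 0 ∧ (Φ [] ∧ Ψ (drop 1 L)))
    ≡⟨ count-suc n (λ L → get L 0 ∧ (Φ [] ∧ Ψ (drop 1 L))) ⟩
  count n (λ L → Φ [] ∧ Ψ L) + count n (λ _ → false)
    ≡⟨ cong₂ _+_ (count-const-∧ (Φ [])) (count-false n (λ _ _ → refl)) ⟩
  count 0 Φ * count n Ψ + 0
    ≡⟨ +-identityʳ _ ⟩
  count 0 Φ * count n Ψ ∎
  where
  count-const-∧ : ∀ b → count n (λ L → b ∧ Ψ L) ≡ count 0 (λ _ → b) * count n Ψ
  count-const-∧ true = sym (+-identityʳ _)
  count-const-∧ false = count-false n (λ _ _ → refl)
count-split {suc n} {suc i} (s≤s i<n) Φ Ψ = begin
  count (suc n) (λ L → get L (suc i) ∧ (Φ (take (suc i) L) ∧ Ψ (drop (2 + i) L)))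
    ≡⟨ count-suc n (λ L → get L (suc i) ∧ (Φ (take (suc i) L) ∧ Ψ (drop (2 + i) L))) ⟩
  count n (λ L → get L i ∧ (Φ (true ∷ take i L) ∧ Ψ (drop (suc i) L)))
    + count n (λ L → get L i ∧ (Φ (false ∷ take i L) ∧ Ψ (drop (suc i) L)))
    ≡⟨ cong₂ _+_ (count-split i<n (λ L → Φ (true ∷ L)) Ψ) (count-split i<n (λ L → Φ (false ∷ L)) Ψ) ⟩
  count i (λ L → Φ (true ∷ L)) * R + count i (λ L → Φ (false ∷ L)) * R
    ≡⟨ sym (*-distribʳ-+ R (count i (λ L → Φ (true ∷ L))) _) ⟩
  (count i (λ L → Φ (true ∷ L)) + count i (λ L → Φ (false ∷ L))) * R
    ≡⟨ cong (_* R) (sym (count-suc i Φ)) ⟩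
  count (suc i) Φ * R ∎
  where R = count (n ∸ suc i) Ψ

-- The scanning automaton

-- Status of the last scanned vertex: in D; not in D but dominated by its left
-- neighbour; not in D and not dominated so far.
data Status : Set where
  chosen covered uncovered : Status

isChosen : Status → Bool
isChosen chosen = true
isChosen _ = false

isCovered : Status → Bool
isCovered uncovered = false
isCovered _ = true

run : (Status → Bool) → Status → List Bool → Bool
run final s [] = final s
run final s (true ∷ L) = run final chosen L
run final chosen (false ∷ L) = run final covered L
run final covered (false ∷ L) = run final uncovered L
run final uncovered (false ∷ L) = false

dominates : Status → List Bool → Bool
dominates = run isCovered

-- A segment that is followed by a vertex of D, which dominates its last vertex.
dominatesBefore : Status → List Bool → Bool
dominatesBefore = run (λ _ → true)

weight : List Bool → ℕ
weight [] = 0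
weight (true ∷ L) = suc (weight L)
weight (false ∷ L) = weight L

#accepted : (Status → Bool) → Status → ℕ → ℕ → ℕ
#accepted final s n w = count n (λ L → run final s L ∧ (weight L ≡ᵇ w))

#dominating : Status → ℕ → ℕ → ℕ
#dominating = #accepted isCovered

#dominatingBefore : Status → ℕ → ℕ → ℕ
#dominatingBefore = #accepted (λ _ → true)

run-split : ∀ final s i L → get L i ≡ true →
  run final s L ≡ dominatesBefore s (take i L) ∧ run final chosen (drop (suc i) L)
run-split final s i [] ()
run-split final s zero (true ∷ L) _ = refl
run-split final s zero (false ∷ L) ()
run-split final s (suc i) (true ∷ L) h = run-split final chosen i L h
run-split final chosen (suc i) (false ∷ L) h = run-split final covered i L h
run-split final covered (suc i) (false ∷ L) h = run-split final uncovered i L h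
run-split final uncovered (suc i) (false ∷ L) h = refl

weight-split : ∀ i L → get L i ≡ true → weight L ≡ weight (take i L) + suc (weight (drop (suc i) L))
weight-split i [] ()
weight-split zero (true ∷ L) _ = refl
weight-split zero (false ∷ L) ()
weight-split (suc i) (true ∷ L) h = cong suc (weight-split i L h)
weight-split (suc i) (false ∷ L) h = weight-split i L h

-- Domination on a path is recognised by the automaton

allBelow : (ℕ → Bool) → ℕ → Bool
allBelow f zero = true
allBelow f (suc n) = f 0 ∧ allBelow (f ∘ suc) n

neighbourIn : List Bool → ℕ → Bool
neighbourIn L zero = get L 1
neighbourIn L (suc i) = get L i ∨ get L (2 + i)

dominatedAt : List Bool → ℕ → Bool
dominatedAt L i = get L i ∨ neighbourIn L i

dominates-windows : ∀ s L →
  dominates s L ≡ (isCovered s ∨ get L 0) ∧ allBelow (λ i → dominatedAt (isChosen s ∷ L) (suc i)) (length L)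
dominates-windows chosen [] = refl
dominates-windows covered [] = refl
dominates-windows uncovered [] = refl
dominates-windows chosen (true ∷ L) = dominates-windows chosen L
dominates-windows covered (true ∷ L) = dominates-windows chosen L
dominates-windows uncovered (true ∷ L) = dominates-windows chosen L
dominates-windows chosen (false ∷ L) = dominates-windows covered L
dominates-windows covered (false ∷ L) = dominates-windows uncovered L
dominates-windows uncovered (false ∷ L) = refl

-- The scan of a whole path starts in status covered: a virtual left neighbour outside D
-- that needs no domination.
dominates-covered : ∀ L → dominates covered L ≡ allBelow (dominatedAt L) (length L)
dominates-covered [] = refl
dominates-covered (true ∷ L) = dominates-windows chosen L
dominates-covered (false ∷ L) = dominates-windows uncovered L

anyᶠ : ∀ {n} → (Fin n → Bool) → Bool
anyᶠ {zero} p = false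
anyᶠ {suc n} p = p zero ∨ anyᶠ (p ∘ suc)

allᶠ : ∀ {n} → (Fin n → Bool) → Bool
allᶠ {zero} p = true
allᶠ {suc n} p = p zero ∧ allᶠ (p ∘ suc)

module _ {A : Set} (p : A → Bool) where

  bany-tabulate : ∀ {n} (f : Fin n → A) → bany p (tabulate f) ≡ anyᶠ (p ∘ f)
  bany-tabulate {zero} f = refl
  bany-tabulate {suc n} f = cong (p (f zero) ∨_) (bany-tabulate (f ∘ suc))

  ball-tabulate : ∀ {n} (f : Fin n → A) → ball p (tabulate f) ≡ allᶠ (p ∘ f)
  ball-tabulate {zero} f = refl
  ball-tabulate {suc n} f = cong (p (f zero) ∧_) (ball-tabulate (f ∘ suc))

allᶠ-cong : ∀ {n} {p q : Fin n → Bool} → (∀ u → p u ≡ q u) → allᶠ p ≡ allᶠ q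
allᶠ-cong {zero} h = refl
allᶠ-cong {suc n} {p} {q} h = cong₂ _∧_ (h zero) (allᶠ-cong {p = p ∘ suc} {q ∘ suc} (h ∘ suc))

allᶠ-toℕ : ∀ {n} (g : ℕ → Bool) → allᶠ {n} (g ∘ toℕ) ≡ allBelow g n
allᶠ-toℕ {zero} g = refl
allᶠ-toℕ {suc n} g = cong (g 0 ∧_) (allᶠ-toℕ {n} (g ∘ suc))

lookup≡get : ∀ {n} (D : Subset n) v → lookup D v ≡ get (toList D) (toℕ v)
lookup≡get (x ∷ D) zero = refl
lookup≡get (x ∷ D) (suc v) = lookup≡get D v

-- ((a ∸ t) + (t ∸ a)) ≡ᵇ 1 is the adjacency test of path; for t = 0 and a = 1 + b it
-- reduces to (b + 0) ≡ᵇ 0.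
anyᶠ-neighbour : ∀ {n} (D : Subset n) t →
  anyᶠ (λ u → lookup D u ∧ (((toℕ u ∸ t) + (t ∸ toℕ u)) ≡ᵇ 1)) ≡ neighbourIn (toList D) t
anyᶠ-neighbour [] zero = refl
anyᶠ-neighbour [] (suc t) = refl
anyᶠ-neighbour (x ∷ D) zero = cong₂ _∨_ (∧-zeroʳ x) (first D)
  where
  none : ∀ {n} (f : Fin n → Bool) → anyᶠ (λ u → f u ∧ false) ≡ false
  none {zero} f = refl
  none {suc n} f = cong₂ _∨_ (∧-zeroʳ (f zero)) (none (f ∘ suc))
  first : ∀ {n} (D : Subset n) → anyᶠ (λ u → lookup D u ∧ ((toℕ u + 0) ≡ᵇ 0)) ≡ get (toList D) 0
  first [] = refl
  first (true ∷ D) = refl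
  first (false ∷ D) = none (lookup D)
anyᶠ-neighbour (x ∷ D) (suc t) = trans (cong ((x ∧ (t ≡ᵇ 0)) ∨_) (anyᶠ-neighbour D t)) (head-neighbour x t)
  where
  head-neighbour : ∀ x t → (x ∧ (t ≡ᵇ 0)) ∨ neighbourIn (toList D) t ≡ neighbourIn (x ∷ toList D) (suc t)
  head-neighbour true zero = refl
  head-neighbour false zero = refl
  head-neighbour true (suc t) = refl
  head-neighbour false (suc t) = refl

isDominating-path : ∀ {n} (D : Subset n) → isDominating (path n) D ≡ dominates covered (toList D)
isDominating-path {n} D = begin
  isDominating (path n) D
    ≡⟨ ball-tabulate _ {n} id ⟩
  allᶠ (λ v → lookup D v ∨ bany (λ u → lookup D u ∧ path n u v) (allFin n))
    ≡⟨ allᶠ-cong {n} {q = dominatedAt (toList D) ∘ toℕ} dominatedAt-v ⟩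
  allᶠ {n} (dominatedAt (toList D) ∘ toℕ)
    ≡⟨ allᶠ-toℕ {n} (dominatedAt (toList D)) ⟩
  allBelow (dominatedAt (toList D)) n
    ≡⟨ cong (allBelow _) (sym (length-toList D)) ⟩
  allBelow (dominatedAt (toList D)) (length (toList D))
    ≡⟨ sym (dominates-covered (toList D)) ⟩
  dominates covered (toList D) ∎
  where
  dominatedAt-v : ∀ v → (lookup D v ∨ bany (λ u → lookup D u ∧ path n u v) (allFin n)) ≡ dominatedAt (toList D) (toℕ v)
  dominatedAt-v v = cong₂ _∨_ (lookup≡get D v) (trans (bany-tabulate _ {n} id) (anyᶠ-neighbour D (toℕ v)))

∣∣≡weight : ∀ {n} (D : Subset n) → ∣ D ∣ ≡ weight (toList D)
∣∣≡weight [] = refl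
∣∣≡weight (true ∷ D) = cong suc (∣∣≡weight D)
∣∣≡weight (false ∷ D) = ∣∣≡weight D

sizedDominatingSets-path : ∀ n m →
  bfilter (λ D → ∣ D ∣ ≡ᵇ m) (dominatingSets (path n))
    ≡ bfilter (λ D → dominates covered (toList D) ∧ (weight (toList D) ≡ᵇ m)) (allSubsets n)
sizedDominatingSets-path n m = trans (bfilter-bfilter _ _ (allSubsets n))
  (bfilter-cong (λ D → cong₂ (λ x y → x ∧ (y ≡ᵇ m)) (isDominating-path D) (∣∣≡weight D)) (allSubsets n))

-- A vertex of D dominates at most three vertices; debt s is the potential that makes
-- this an invariant of the scan.
debt : Status → ℕ
debt chosen = 0
debt covered = 1
debt uncovered = 2

run-length≤ : ∀ {final} c → (∀ s → final s ≡ true → debt s ≤ c) →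
  ∀ s L → run final s L ≡ true → debt s + length L ≤ weight L * 3 + c
run-length≤ c bounded s [] h = subst (_≤ c) (sym (+-identityʳ (debt s))) (bounded s h)
run-length≤ c bounded chosen (true ∷ L) h = s≤s (≤-trans (run-length≤ c bounded chosen L h) (m≤n+m _ 2))
run-length≤ c bounded covered (true ∷ L) h = s≤s (s≤s (≤-trans (run-length≤ c bounded chosen L h) (m≤n+m _ 1)))
run-length≤ c bounded uncovered (true ∷ L) h = s≤s (s≤s (s≤s (run-length≤ c bounded chosen L h)))
run-length≤ c bounded chosen (false ∷ L) h = run-length≤ c bounded covered L h
run-length≤ c bounded covered (false ∷ L) h = run-length≤ c bounded uncovered L h
run-length≤ c bounded uncovered (false ∷ L) ()

covered-debt≤1 : ∀ s → isCovered s ≡ true → debt s ≤ 1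
covered-debt≤1 chosen _ = z≤n
covered-debt≤1 covered _ = s≤s z≤n
covered-debt≤1 uncovered ()

debt≤2 : ∀ s → debt s ≤ 2
debt≤2 chosen = z≤n
debt≤2 covered = s≤s z≤n
debt≤2 uncovered = s≤s (s≤s z≤n)

dominates-weight≥ : ∀ o {m} s L → o + m * 3 ≡ suc (debt s + length L) → dominates s L ≡ true → m ≤ weight L
dominates-weight≥ o s L eq ok =
  o+m*3≤n*3+2⇒m≤n o (subst₂ _≤_ (sym eq) (sym (+-suc _ 1)) (s≤s (run-length≤ 1 covered-debt≤1 s L ok)))

dominatesBefore-weight≥ : ∀ o {m} s L → o + m * 3 ≡ debt s + length L → dominatesBefore s L ≡ true → m ≤ weight L
dominatesBefore-weight≥ o s L eq ok =
  o+m*3≤n*3+2⇒m≤n o (subst (_≤ weight L * 3 + 2) (sym eq) (run-length≤ 2 (λ s _ → debt≤2 s) s L ok))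

#accepted-vanishes : ∀ {final} c → (∀ s → final s ≡ true → debt s ≤ c) →
  ∀ n w → c + w * 3 < n → #accepted final chosen n w ≡ 0
#accepted-vanishes {final} c bounded n w short = count-false n too-long
  where
  too-long : ∀ L → length L ≡ n → (run final chosen L ∧ (weight L ≡ᵇ w)) ≡ false
  too-long L eL with run final chosen L in accepted | weight L ≡ᵇ w in weighs
  ... | false | _ = refl
  ... | true | false = refl
  ... | true | true = contradiction (subst₂ (λ ℓ x → ℓ ≤ x * 3 + c) eL (≡ᵇ≡true⇒≡ {weight L} {w} weighs) bound)
                                      (<⇒≱ (subst (_< n) (+-comm c (w * 3)) short))
    where
    bound : length L ≤ weight L * 3 + c
    bound = run-length≤ c bounded chosen L accepted

-- Recurrences for the counts

module _ (final : Status → Bool) where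

  #accepted-suc : ∀ s n w → #accepted final s (suc n) (suc w)
    ≡ #accepted final chosen n w + count n (λ L → run final s (false ∷ L) ∧ (weight L ≡ᵇ suc w))
  #accepted-suc s n w = count-suc n (λ L → run final s L ∧ (weight L ≡ᵇ suc w))

  covered-recurrence : ∀ n w →
    #accepted final covered (2 + n) (suc w) ≡ #accepted final chosen (1 + n) w + #accepted final chosen n w
  covered-recurrence n w = trans (#accepted-suc covered (suc n) w) (cong (#accepted final chosen (suc n) w +_) (begin
    #accepted final uncovered (suc n) (suc w)      ≡⟨ #accepted-suc uncovered n w ⟩
    #accepted final chosen n w + count n (λ _ → false)  ≡⟨ cong (#accepted final chosen n w +_) (count-false n (λ _ _ → refl)) ⟩
    #accepted final chosen n w + 0                 ≡⟨ +-identityʳ _ ⟩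
    #accepted final chosen n w                     ∎))

  chosen-recurrence : ∀ n w → #accepted final chosen (3 + n) (suc w)
    ≡ #accepted final chosen (2 + n) w + (#accepted final chosen (1 + n) w + #accepted final chosen n w)
  chosen-recurrence n w =
    trans (#accepted-suc chosen (2 + n) w) (cong (#accepted final chosen (2 + n) w +_) (covered-recurrence n w))

-- Since C vanishes beyond the line n = d + 1 + 3w, the recurrence makes C constant on that
-- line, then increase by 1 per step on the line below it, and by a linear term on the next.
module LinearRecurrence (C : ℕ → ℕ → ℕ) (d : ℕ)
  (recurrence : ∀ n w → C (3 + n) (suc w) ≡ C (2 + n) w + (C (1 + n) w + C n w))
  (vanishes : ∀ n w → suc d + w * 3 < n → C n w ≡ 0)
  (base₀ : C d 0 ≡ 1) (base₁ : C (suc d) 0 ≡ 1) (base₂ : C (2 + d) 1 ≡ 2 + d)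
  where

  shift : ∀ w → d + suc w * 3 ≡ 3 + (d + w * 3)
  shift w = expand d w
    where
    expand : ∀ d w → d + suc w * 3 ≡ 3 + (d + w * 3)
    expand = solve-∀

  ones : ∀ w → C (suc d + w * 3) w ≡ 1
  ones zero = trans (cong (λ n → C n 0) (+-identityʳ (suc d))) base₁
  ones (suc w) = begin
    C (suc (d + suc w * 3)) (suc w)       ≡⟨ cong (λ n → C (suc n) (suc w)) (shift w) ⟩
    C (3 + x) (suc w)                     ≡⟨ recurrence x w ⟩
    C (2 + x) w + (C (1 + x) w + C x w)   ≡⟨ cong₂ _+_ (vanishes _ w (m<n+m x {2} z<s)) (cong (_+ C x w) (vanishes _ w (n<1+n x))) ⟩
    C x w                                 ≡⟨ ones w ⟩
    1                                     ∎
    where x = suc d + w * 3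

  linear : ∀ w → C (d + w * 3) w ≡ suc w
  linear zero = trans (cong (λ n → C n 0) (+-identityʳ d)) base₀
  linear (suc w) = begin
    C (d + suc w * 3) (suc w)             ≡⟨ cong (λ n → C n (suc w)) (shift w) ⟩
    C (3 + x) (suc w)                     ≡⟨ recurrence x w ⟩
    C (2 + x) w + (C (1 + x) w + C x w)   ≡⟨ cong₂ _+_ (vanishes _ w (n<1+n (suc x))) (cong₂ _+_ (ones w) (linear w)) ⟩
    suc (suc w)                           ∎
    where x = d + w * 3

  quadratic : ∀ w → 2 * C (2 + d + w * 3) (suc w) ≡ suc w * (w + 4) + 2 * d
  quadratic zero = begin
    2 * C (2 + d + 0) 1   ≡⟨ cong (λ n → 2 * C n 1) (+-identityʳ (2 + d)) ⟩
    2 * C (2 + d) 1       ≡⟨ cong (2 *_) base₂ ⟩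
    2 * (2 + d)           ≡⟨ expand d ⟩
    1 * 4 + 2 * d         ∎
    where
    expand : ∀ d → 2 * (2 + d) ≡ 1 * 4 + 2 * d
    expand = solve-∀
  quadratic (suc w) = begin
    2 * C (2 + (d + suc w * 3)) (2 + w)
      ≡⟨ cong (λ n → 2 * C (2 + n) (2 + w)) (shift w) ⟩
    2 * C (3 + (2 + x)) (2 + w)
      ≡⟨ cong (2 *_) (recurrence (2 + x) (suc w)) ⟩
    2 * (C (4 + x) (suc w) + (C (3 + x) (suc w) + C (2 + x) (suc w)))
      ≡⟨ cong (λ m → 2 * m) (cong₂ _+_ ones′ (cong (_+ C (2 + x) (suc w)) linear′)) ⟩
    2 * (3 + w + C (2 + x) (suc w))
      ≡⟨ *-distribˡ-+ 2 (3 + w) _ ⟩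
    2 * (3 + w) + 2 * C (2 + x) (suc w)
      ≡⟨ cong (2 * (3 + w) +_) (quadratic w) ⟩
    2 * (3 + w) + (suc w * (w + 4) + 2 * d)
      ≡⟨ expand w d ⟩
    suc (suc w) * (suc w + 4) + 2 * d ∎
    where
    x = d + w * 3
    ones′ : C (4 + x) (suc w) ≡ 1
    ones′ = trans (cong (λ n → C (suc n) (suc w)) (sym (shift w))) (ones (suc w))
    linear′ : C (3 + x) (suc w) ≡ 2 + w
    linear′ = trans (cong (λ n → C n (suc w)) (sym (shift w))) (linear (suc w))
    expand : ∀ w d → 2 * (3 + w) + (suc w * (w + 4) + 2 * d) ≡ suc (suc w) * (suc w + 4) + 2 * d
    expand = solve-∀

module Dominating = LinearRecurrence (#dominating chosen) 0 (chosen-recurrence isCovered)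
  (#accepted-vanishes 1 covered-debt≤1) refl refl refl

module DominatingBefore = LinearRecurrence (#dominatingBefore chosen) 1 (chosen-recurrence _)
  (#accepted-vanishes 2 (λ s _ → debt≤2 s)) refl refl refl

dominating-covered : ∀ t → 2 * #dominating covered (1 + suc t * 3) (2 + t) ≡ suc t * suc t + 5 * suc t + 2
dominating-covered t = begin
  2 * #dominating covered (2 + (2 + t * 3)) (2 + t)
    ≡⟨ cong (2 *_) (covered-recurrence isCovered (2 + t * 3) (suc t)) ⟩
  2 * (#dominating chosen (suc t * 3) (suc t) + #dominating chosen (2 + t * 3) (suc t))
    ≡⟨ *-distribˡ-+ 2 (#dominating chosen (suc t * 3) (suc t)) _ ⟩
  2 * #dominating chosen (suc t * 3) (suc t) + 2 * #dominating chosen (2 + t * 3) (suc t)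
    ≡⟨ cong₂ _+_ (cong (2 *_) (Dominating.linear (suc t))) (Dominating.quadratic t) ⟩
  2 * (2 + t) + (suc t * (t + 4) + 2 * 0)
    ≡⟨ expand t ⟩
  suc t * suc t + 5 * suc t + 2 ∎
  where
  expand : ∀ t → 2 * (2 + t) + (suc t * (t + 4) + 2 * 0) ≡ suc t * suc t + 5 * suc t + 2
  expand = solve-∀

dominatingBefore-covered-linear : ∀ q → #dominatingBefore covered (q * 3) q ≡ suc q
dominatingBefore-covered-linear zero = refl
dominatingBefore-covered-linear (suc q) = trans (covered-recurrence _ (1 + q * 3) q)
  (cong₂ _+_ (DominatingBefore.ones q) (DominatingBefore.linear q))

dominatingBefore-covered-ones : ∀ q → #dominatingBefore covered (1 + q * 3) q ≡ 1
dominatingBefore-covered-ones zero = refl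
dominatingBefore-covered-ones (suc q) = trans (covered-recurrence _ (2 + q * 3) q)
  (cong₂ _+_ (#accepted-vanishes 2 (λ s _ → debt≤2 s) (3 + q * 3) q (n<1+n _)) (DominatingBefore.ones q))

dominatingBefore-covered-quadratic : ∀ q → 2 * #dominatingBefore covered (2 + q * 3) (suc q) ≡ suc q * (q + 4)
dominatingBefore-covered-quadratic zero = refl
dominatingBefore-covered-quadratic (suc q) = begin
  2 * #dominatingBefore covered (2 + (3 + q * 3)) (2 + q)
    ≡⟨ cong (2 *_) (covered-recurrence _ (3 + q * 3) (suc q)) ⟩
  2 * (#dominatingBefore chosen (1 + suc q * 3) (suc q) + #dominatingBefore chosen (3 + q * 3) (suc q))
    ≡⟨ *-distribˡ-+ 2 (#dominatingBefore chosen (1 + suc q * 3) (suc q)) _ ⟩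
  2 * #dominatingBefore chosen (1 + suc q * 3) (suc q) + 2 * #dominatingBefore chosen (3 + q * 3) (suc q)
    ≡⟨ cong₂ _+_ (cong (2 *_) (DominatingBefore.linear (suc q))) (DominatingBefore.quadratic q) ⟩
  2 * (2 + q) + (suc q * (q + 4) + 2 * 1)
    ≡⟨ expand q ⟩
  suc (suc q) * (suc q + 4) ∎
  where
  expand : ∀ q → 2 * (2 + q) + (suc q * (q + 4) + 2 * 1) ≡ suc (suc q) * (suc q + 4)
  expand = solve-∀

-- γ, τ and DV of a path

≤-foldr-⊓ : ∀ {A : Set} (p : A → Bool) (size : A → ℕ) xs {b c} →
  (∀ x → p x ≡ true → b ≤ size x) → b ≤ c → b ≤ foldr _⊓_ c (map size (bfilter p xs))
≤-foldr-⊓ p size [] lower b≤c = b≤c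
≤-foldr-⊓ p size (x ∷ xs) lower b≤c with p x in px
... | true = ⊓-glb (lower x px) (≤-foldr-⊓ p size xs lower b≤c)
... | false = ≤-foldr-⊓ p size xs lower b≤c

foldr-⊓-≤ : ∀ {A : Set} (p : A → Bool) (size : A → ℕ) xs {b c} →
  length (bfilter (λ x → size x ≡ᵇ b) (bfilter p xs)) ≢ 0 → foldr _⊓_ c (map size (bfilter p xs)) ≤ b
foldr-⊓-≤ p size [] nonempty = contradiction refl nonempty
foldr-⊓-≤ p size (x ∷ xs) {b} nonempty with p x
... | false = foldr-⊓-≤ p size xs nonempty
... | true with size x ≡ᵇ b in sized
...   | true = ≤-trans (m⊓n≤m _ _) (≤-reflexive (≡ᵇ≡true⇒≡ sized))
...   | false = ≤-trans (m⊓n≤n (size x) _) (foldr-⊓-≤ p size xs nonempty)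

γ≡ : ∀ {n} (G : Graph n) m → m ≤ n → (∀ D → isDominating G D ≡ true → m ≤ ∣ D ∣) →
  length (bfilter (λ D → ∣ D ∣ ≡ᵇ m) (dominatingSets G)) ≢ 0 → γ G ≡ m
γ≡ {n} G m m≤n lower attained =
  ≤-antisym (foldr-⊓-≤ _ ∣_∣ (allSubsets n) attained) (≤-foldr-⊓ _ ∣_∣ (allSubsets n) lower m≤n)

τ≡#dominating : ∀ n → τ (path n) ≡ #dominating covered n (γ (path n))
τ≡#dominating n = cong length (sizedDominatingSets-path n (γ (path n)))

γ-path : ∀ t {n} → n ≡ 1 + suc t * 3 → γ (path n) ≡ 2 + t
γ-path t {n} refl = γ≡ (path n) (2 + t) (s≤s (m≤m*n (suc t) 3)) lower attained
  where
  lower : ∀ D → isDominating (path n) D ≡ true → 2 + t ≤ ∣ D ∣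
  lower D dom = subst (2 + t ≤_) (sym (∣∣≡weight D))
    (dominates-weight≥ 0 covered (toList D) (cong (2 +_) (sym (length-toList D)))
      (trans (sym (isDominating-path D)) dom))
  attained : length (bfilter (λ D → ∣ D ∣ ≡ᵇ 2 + t) (dominatingSets (path n))) ≢ 0
  attained none = 0≢1+n (trans (sym (cong (2 *_)
    (trans (sym (cong length (sizedDominatingSets-path n (2 + t)))) none))) (dominating-covered t))

τ-path : ∀ t {n} → n ≡ 1 + suc t * 3 → 2 * τ (path n) ≡ suc t * suc t + 5 * suc t + 2
τ-path t {n} refl = begin
  2 * τ (path n)                            ≡⟨ cong (2 *_) (τ≡#dominating n) ⟩
  2 * #dominating covered n (γ (path n))    ≡⟨ cong (λ m → 2 * #dominating covered n m) (γ-path t refl) ⟩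
  2 * #dominating covered n (2 + t)         ≡⟨ dominating-covered t ⟩
  suc t * suc t + 5 * suc t + 2             ∎

DV≡count : ∀ n (v : Fin n) →
  DV (path n) v ≡ count n (λ L → (dominates covered L ∧ (weight L ≡ᵇ γ (path n))) ∧ get L (toℕ v))
DV≡count n v = begin
  length (bfilter (λ D → lookup D v) (bfilter (λ D → ∣ D ∣ ≡ᵇ γ (path n)) (dominatingSets (path n))))
    ≡⟨ cong (λ Ds → length (bfilter (λ D → lookup D v) Ds)) (sizedDominatingSets-path n (γ (path n))) ⟩
  length (bfilter (λ D → lookup D v) (bfilter (Q ∘ toList) (allSubsets n)))
    ≡⟨ cong length (bfilter-bfilter (Q ∘ toList) (λ D → lookup D v) (allSubsets n)) ⟩
  length (bfilter (λ D → Q (toList D) ∧ lookup D v) (allSubsets n))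
    ≡⟨ cong length (bfilter-cong (λ D → cong (Q (toList D) ∧_) (lookup≡get D v)) (allSubsets n)) ⟩
  count n (λ L → Q L ∧ get L (toℕ v)) ∎
  where
  Q : List Bool → Bool
  Q L = dominates covered L ∧ (weight L ≡ᵇ γ (path n))

DV-path : ∀ {n} (v : Fin n) {j w} → γ (path n) ≡ j + suc w →
  (∀ L → length L ≡ toℕ v → dominatesBefore covered L ≡ true → j ≤ weight L) →
  (∀ R → length R ≡ n ∸ suc (toℕ v) → dominates chosen R ≡ true → w ≤ weight R) →
  DV (path n) v ≡ #dominatingBefore covered (toℕ v) j * #dominating chosen (n ∸ suc (toℕ v)) w
DV-path {n} v {j} {w} eγ prefix≥ suffix≥ = begin
  DV (path n) v
    ≡⟨ DV≡count n v ⟩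
  count n (λ L → (dominates covered L ∧ (weight L ≡ᵇ γ (path n))) ∧ get L i)
    ≡⟨ cong (λ m → count n (λ L → (dominates covered L ∧ (weight L ≡ᵇ m)) ∧ get L i)) eγ ⟩
  count n (λ L → (dominates covered L ∧ (weight L ≡ᵇ j + suc w)) ∧ get L i)
    ≡⟨ count-cong n split-at-v ⟩
  count n (λ L → get L i ∧ (P (take i L) ∧ R (drop (suc i) L)))
    ≡⟨ count-split (toℕ<n v) P R ⟩
  count i P * count (n ∸ suc i) R ∎
  where
  i = toℕ v
  P R : List Bool → Bool
  P L = dominatesBefore covered L ∧ (weight L ≡ᵇ j)
  R L = dominates chosen L ∧ (weight L ≡ᵇ w)
  split-at-v : ∀ L → length L ≡ n →
    ((dominates covered L ∧ (weight L ≡ᵇ j + suc w)) ∧ get L i) ≡ get L i ∧ (P (take i L) ∧ R (drop (suc i) L))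
  split-at-v L eL with get L i in chosen-i
  ... | false = ∧-zeroʳ _
  ... | true = begin
    (dominates covered L ∧ (weight L ≡ᵇ j + suc w)) ∧ true
      ≡⟨ ∧-identityʳ _ ⟩
    dominates covered L ∧ (weight L ≡ᵇ j + suc w)
      ≡⟨ cong₂ (λ x y → x ∧ (y ≡ᵇ j + suc w)) (run-split isCovered covered i L chosen-i) (weight-split i L chosen-i) ⟩
    (dominatesBefore covered (take i L) ∧ dominates chosen (drop (suc i) L))
      ∧ (weight (take i L) + suc (weight (drop (suc i) L)) ≡ᵇ j + suc w)
      ≡⟨ ∧-regroup (dominatesBefore covered (take i L)) (dominates chosen (drop (suc i) L))
           (λ p r → +-suc-≡ᵇ-at-minimum (prefix≥ (take i L) length-prefix p)
                                        (suffix≥ (drop (suc i) L) length-suffix r)) ⟩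
    P (take i L) ∧ R (drop (suc i) L) ∎
    where
    length-prefix : length (take i L) ≡ i
    length-prefix = trans (length-take i L) (trans (cong (i ⊓_) eL) (m≤n⇒m⊓n≡m (<⇒≤ (toℕ<n v))))
    length-suffix : length (drop (suc i) L) ≡ n ∸ suc i
    length-suffix = trans (length-drop (suc i) L) (cong (_∸ suc i) eL)

DV-3q+1 : ∀ k q {n} (v : Fin n) → n ≡ 1 + k * 3 → γ (path n) ≡ suc k → suc (toℕ v) ≡ 1 + q * 3 →
  DV (path n) v ≡ (q + 1) * (k ∸ q + 1)
DV-3q+1 k q v refl eγ eV with m≤n⇒∃[o]m+o≡n (*-cancelʳ-≤ q k 3 (≤-pred (subst (_≤ 1 + k * 3) eV (toℕ<n v))))
... | b , refl = begin
  DV (path _) v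
    ≡⟨ DV-path v (trans eγ (sym (+-suc q b)))
         (λ L eL → dominatesBefore-weight≥ 1 covered L (cong suc (sym (trans eL eI))))
         (λ R eR′ → dominates-weight≥ 1 chosen R (cong suc (sym (trans eR′ eR)))) ⟩
  #dominatingBefore covered (toℕ v) q * #dominating chosen (1 + (q + b) * 3 ∸ suc (toℕ v)) b
    ≡⟨ cong₂ (λ x y → #dominatingBefore covered x q * #dominating chosen y b) eI eR ⟩
  #dominatingBefore covered (q * 3) q * #dominating chosen (b * 3) b
    ≡⟨ cong₂ _*_ (dominatingBefore-covered-linear q) (Dominating.linear b) ⟩
  suc q * suc b
    ≡⟨ cong₂ _*_ (+-comm 1 q) (trans (+-comm 1 b) (cong (_+ 1) (sym (m+n∸m≡n q b)))) ⟩
  (q + 1) * (q + b ∸ q + 1) ∎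
  where
  eI : toℕ v ≡ q * 3
  eI = suc-injective eV
  eR : 1 + (q + b) * 3 ∸ suc (toℕ v) ≡ b * 3
  eR = n≡m+r⇒n∸m≡r {suc (toℕ v)} (trans (expand q b) (cong (_+ b * 3) (sym eV)))
    where
    expand : ∀ q b → 1 + (q + b) * 3 ≡ 1 + q * 3 + b * 3
    expand = solve-∀

DV-3q+2 : ∀ k q {n} (v : Fin n) → n ≡ 1 + k * 3 → γ (path n) ≡ suc k → suc (toℕ v) ≡ 2 + q * 3 →
  2 * DV (path n) v ≡ (k ∸ q) * (k ∸ q + 3)
DV-3q+2 k q v refl eγ eV with m<n⇒∃[o]m+1+o≡n (*-cancelʳ-< 3 q k (≤-pred (subst (_≤ 1 + k * 3) eV (toℕ<n v))))
... | b , refl = begin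
  2 * DV (path _) v
    ≡⟨ cong (2 *_) (DV-path v (trans eγ (sym (+-suc q (suc b))))
         (λ L eL → dominatesBefore-weight≥ 2 covered L (cong suc (sym (trans eL eI))))
         (λ R eR′ → dominates-weight≥ 0 chosen R (cong suc (sym (trans eR′ eR))))) ⟩
  2 * (#dominatingBefore covered (toℕ v) q * #dominating chosen (1 + (q + suc b) * 3 ∸ suc (toℕ v)) (suc b))
    ≡⟨ cong₂ (λ x y → 2 * (#dominatingBefore covered x q * #dominating chosen y (suc b))) eI eR ⟩
  2 * (#dominatingBefore covered (1 + q * 3) q * #dominating chosen (2 + b * 3) (suc b))
    ≡⟨ cong (λ x → 2 * (x * #dominating chosen (2 + b * 3) (suc b))) (dominatingBefore-covered-ones q) ⟩
  2 * (1 * #dominating chosen (2 + b * 3) (suc b))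
    ≡⟨ cong (2 *_) (*-identityˡ (#dominating chosen (2 + b * 3) (suc b))) ⟩
  2 * #dominating chosen (2 + b * 3) (suc b)
    ≡⟨ Dominating.quadratic b ⟩
  suc b * (b + 4) + 0
    ≡⟨ +-identityʳ (suc b * (b + 4)) ⟩
  suc b * (b + 4)
    ≡⟨ cong (suc b *_) (+-suc b 3) ⟩
  suc b * (suc b + 3)
    ≡⟨ cong (λ x → x * (x + 3)) (sym (m+n∸m≡n q (suc b))) ⟩
  (q + suc b ∸ q) * (q + suc b ∸ q + 3) ∎
  where
  eI : toℕ v ≡ 1 + q * 3
  eI = suc-injective eV
  eR : 1 + (q + suc b) * 3 ∸ suc (toℕ v) ≡ 2 + b * 3
  eR = n≡m+r⇒n∸m≡r {suc (toℕ v)} (trans (expand q b) (cong (_+ (2 + b * 3)) (sym eV)))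
    where
    expand : ∀ q b → 1 + (q + suc b) * 3 ≡ 2 + q * 3 + (2 + b * 3)
    expand = solve-∀

DV-3q+3 : ∀ k q {n} (v : Fin n) → n ≡ 1 + k * 3 → γ (path n) ≡ suc k → suc (toℕ v) ≡ q * 3 →
  2 * DV (path n) v ≡ q * (q + 3)
DV-3q+3 k zero v refl eγ ()
DV-3q+3 k (suc p) v refl eγ eV
  with m<n⇒∃[o]m+1+o≡n (*-cancelʳ-< 3 p k (≤-trans (n≤1+n _) (≤-pred (subst (_≤ 1 + k * 3) eV (toℕ<n v)))))
... | b , refl = begin
  2 * DV (path _) v
    ≡⟨ cong (2 *_) (DV-path v eγ
         (λ L eL → dominatesBefore-weight≥ 0 covered L (cong suc (sym (trans eL eI))))
         (λ R eR′ → dominates-weight≥ 2 chosen R (cong suc (sym (trans eR′ eR))))) ⟩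
  2 * (#dominatingBefore covered (toℕ v) (suc p) * #dominating chosen (1 + (p + suc b) * 3 ∸ suc (toℕ v)) b)
    ≡⟨ cong₂ (λ x y → 2 * (#dominatingBefore covered x (suc p) * #dominating chosen y b)) eI eR ⟩
  2 * (#dominatingBefore covered (2 + p * 3) (suc p) * #dominating chosen (1 + b * 3) b)
    ≡⟨ cong (λ x → 2 * (#dominatingBefore covered (2 + p * 3) (suc p) * x)) (Dominating.ones b) ⟩
  2 * (#dominatingBefore covered (2 + p * 3) (suc p) * 1)
    ≡⟨ cong (2 *_) (*-identityʳ (#dominatingBefore covered (2 + p * 3) (suc p))) ⟩
  2 * #dominatingBefore covered (2 + p * 3) (suc p)
    ≡⟨ dominatingBefore-covered-quadratic p ⟩
  suc p * (p + 4)
    ≡⟨ cong (suc p *_) (+-suc p 3) ⟩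
  suc p * (suc p + 3) ∎
  where
  eI : toℕ v ≡ 2 + p * 3
  eI = suc-injective eV
  eR : 1 + (p + suc b) * 3 ∸ suc (toℕ v) ≡ 1 + b * 3
  eR = n≡m+r⇒n∸m≡r {suc (toℕ v)} (trans (expand p b) (cong (_+ (1 + b * 3)) (sym eV)))
    where
    expand : ∀ p b → 1 + (p + suc b) * 3 ≡ 3 + p * 3 + (1 + b * 3)
    expand = solve-∀

proposition5p3 : (k : ℕ) → 1 ≤ k →
    (2 * τ (path (3 * k + 1)) ≡ k * k + 5 * k + 2)
    × ((v : Fin (3 * k + 1)) →
          (suc (toℕ v) % 3 ≡ 0 →
             2 * DV (path (3 * k + 1)) v ≡ (suc (toℕ v) / 3) * (suc (toℕ v) / 3 + 3))
        × (suc (toℕ v) % 3 ≡ 1 →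
             DV (path (3 * k + 1)) v ≡ (suc (toℕ v) / 3 + 1) * (k ∸ suc (toℕ v) / 3 + 1))
        × (suc (toℕ v) % 3 ≡ 2 →
             2 * DV (path (3 * k + 1)) v ≡ (k ∸ suc (toℕ v) / 3) * (k ∸ suc (toℕ v) / 3 + 3)))
proposition5p3 (suc t) _ =
  τ-path t n≡ , λ v → (DV-3q+3 k (q v) v n≡ γ≡suc-k ∘ label v)
                    , (DV-3q+1 k (q v) v n≡ γ≡suc-k ∘ label v)
                    , (DV-3q+2 k (q v) v n≡ γ≡suc-k ∘ label v)
  where
  k = suc t
  n≡ : 3 * k + 1 ≡ 1 + k * 3
  n≡ = expand k
    where
    expand : ∀ k → 3 * k + 1 ≡ 1 + k * 3
    expand = solve-∀
  γ≡suc-k : γ (path (3 * k + 1)) ≡ suc k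
  γ≡suc-k = γ-path t n≡
  q : Fin (3 * k + 1) → ℕ
  q v = suc (toℕ v) / 3
  label : (v : Fin (3 * k + 1)) → ∀ {r} → suc (toℕ v) % 3 ≡ r → suc (toℕ v) ≡ r + q v * 3
  label v h = trans (m≡m%n+[m/n]*n (suc (toℕ v)) 3) (cong (_+ _) h)
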